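{- Let $f$ be a function computable by an $M$-memory $(T(n),IO(n))$-time Turing machine with two-level memory (TM-TLM). Then there is a $1$-memory $(T(n),T(n)+IO(n))$-time TM-TLM that computes $f$.
   Context: A Turing machine with two-level memory (TM-TLM) with main memory size $M$ has three tapes: a main memory tape consisting of exactly $M$ cells, an unbounded external memory tape, and an address tape for the external memory. It has a finite set of states $Q$, an input alphabet $\Sigma$, a tape alphabet $\Gamma\supseteq\Sigma$ containing a blank symbol $B\notin\Sigma$, a transition function $\delta:Q\times\Gamma\to Q\times\Gamma\times\{L,S,R\}$ acting on the main memory tape, an accepting state $q_f$, and two distinguished sets of states: Read states and Write states. When the machine enters a Read state, it writes an address $addr$ on the address tape, and the content of the main memory cell under the main memory head is replaced by the content of the cell at address $addr$ of the external tape. When it enters a Write state, it writes an address $addr$ on the address tape, and the content of the external cell at address $addr$ is replaced by the content of the main memory cell under the main memory head. After a Read or Write operation the head may move left, right, or stay. Each Read/Write operation takes one unit of time (they act as oracles). The input resides on the external tape. For a machine $\mathcal{M}$ and input $x$: the time $T_{\mathcal{M}}(x)$ is the number of transitions executed other than Read and Write operations; the IO time $IO_{\mathcal{M}}(x)$ is the number of Read and Write operations executed; the space $S_{\mathcal{M}}(x)$ is the number of external tape cells used. $\mathcal{M}$ has time complexity $O(T(n))$ if $T_{\mathcal{M}}(x)=O(T(n))$ for almost all $n\in\mathbb{Z}^+$ and all $x$ with $|x|=n$; IO complexity and space complexity are defined analogously. An $M$-memory $(T(n),IO(n))$-time TM-TLM is one with main memory size $M$, time complexity $O(T(n))$ and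 IO complexity $O(IO(n))$. Throughout it is assumed that $M<n$. -}

module Defs where

open import Data.Nat using (ℕ; zero; suc; _+_; _*_; _≤_; _≡ᵇ_)
open import Data.Fin using (Fin; zero; suc; toℕ; inject₁)
open import Data.Bool using (Bool; true; false; if_then_else_)
open import Data.List using (List; []; _∷_; length; reverse; _++_; lookup)
open import Data.Vec using (Vec; replicate; _[_]≔_) renaming (lookup to vlookup)
open import Data.Product using (Σ; ∃; _×_; _,_)
open import Relation.Binary.PropositionalEquality using (_≡_; _≢_)
open import Relation.Nullary using (¬_)
open import Function.Definitions using (Injective)

-- Conventions:
--  * Σ = Fin s, Γ = Fin nΓ, states Q = Fin nQ (finite sets).
--  * Main memory: exactly M cells (a Vec), head in Fin M; a move off
--    either end of the main memory leaves the head where it is.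
--  * External tape: ℕ → Γ (unbounded), input at cells 0..n-1, rest blank.
--  * Address tape: a one-way infinite binary tape (cells initially 0)
--    with its own head, manipulated by ordinary transitions; the address
--    used by a Read/Write operation is the binary number written on it
--    (least significant bit in cell 0).
--  * Each state is normal, Read or Write (disjoint).

data Move : Set where
  L S R : Move

data Kind : Set where
  normal readK writeK : Kind

record TLM (s M : ℕ) : Set where
  field
    nQ      : ℕ
    nΓ      : ℕ
    blank   : Fin nΓ
    sym     : Fin s → Fin nΓ                 -- the inclusion Σ ⊆ Γ
    sym-inj : Injective _≡_ _≡_ sym
    blank∉Σ : ∀ a → sym a ≢ blank
    -- transition function on (state, main memory symbol, address-tape bit)
    δ       : Fin nQ → Fin nΓ → Bool → Fin nQ × Fin nΓ × Move × Bool × Move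
    kind    : Fin nQ → Kind
    ioNext  : Fin nQ → Fin nQ × Move
    q₀      : Fin nQ
    qf      : Fin nQ

-- address tape as a zipper: cells left of head (nearest first), current, right
record AddrTape : Set where
  constructor ⟨_,_,_⟩
  field
    leftA  : List Bool
    curA   : Bool
    rightA : List Bool

open AddrTape public

moveA : Move → AddrTape → AddrTape
moveA L ⟨ [] , c , r ⟩ = ⟨ [] , c , r ⟩
moveA L ⟨ b ∷ l , c , r ⟩ = ⟨ l , b , c ∷ r ⟩
moveA S t = t
moveA R ⟨ l , c , [] ⟩ = ⟨ c ∷ l , false , [] ⟩
moveA R ⟨ l , c , b ∷ r ⟩ = ⟨ c ∷ l , b , r ⟩

bin : List Bool → ℕ
bin [] = 0
bin (b ∷ bs) = (if b then 1 else 0) + 2 * bin bs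

address : AddrTape → ℕ
address ⟨ l , c , r ⟩ = bin (reverse l ++ (c ∷ r))

moveR : ∀ {M} → Fin M → Fin M
moveR {suc zero} zero = zero
moveR {suc (suc m)} zero = suc zero
moveR {suc (suc m)} (suc i) = suc (moveR i)

moveL : ∀ {M} → Fin M → Fin M
moveL zero = zero
moveL (suc i) = inject₁ i

moveH : ∀ {M} → Move → Fin M → Fin M
moveH L i = moveL i
moveH S i = i
moveH R i = moveR i

update : {A : Set} → (ℕ → A) → ℕ → A → ℕ → A
update g k a i = if i ≡ᵇ k then a else g i

record Config (nQ nΓ M : ℕ) : Set where
  field
    state : Fin nQ
    mem   : Vec (Fin nΓ) M
    head  : Fin M
    atape : AddrTape
    ext   : ℕ → Fin nΓ

open Config public

data Cost : Set where
  timeC ioC : Cost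

module _ {s M : ℕ} (𝓜 : TLM s M) where
  open TLM 𝓜

  Conf : Set
  Conf = Config nQ nΓ M

  stepK : Kind → Conf → Cost × Conf
  stepK normal c with δ (state c) (vlookup (mem c) (head c)) (curA (atape c))
  ... | q' , b , mv , bit , amv =
    timeC , record { state = q'
                   ; mem = mem c [ head c ]≔ b
                   ; head = moveH mv (head c)
                   ; atape = moveA amv (record (atape c) { curA = bit })
                   ; ext = ext c }
  stepK readK c with ioNext (state c)
  ... | q' , mv =
    ioC , record { state = q'
                 ; mem = mem c [ head c ]≔ ext c (address (atape c))
                 ; head = moveH mv (head c)
                 ; atape = atape c
                 ; ext = ext c }
  stepK writeK c with ioNext (state c)
  ... | q' , mv =
    ioC , record { state = q'
                 ; mem = mem c
                 ; head = moveH mv (head c)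
                 ; atape = atape c
                 ; ext = update (ext c) (address (atape c)) (vlookup (mem c) (head c)) }

  -- one step of the machine (only used from non-accepting states)
  step : Conf → Cost × Conf
  step c = stepK (kind (state c)) c

  data Reach : Conf → ℕ → ℕ → Conf → Set where
    done   : ∀ {c} → Reach c 0 0 c
    stepT  : ∀ {c c' d t io} → state c ≢ qf → step c ≡ (timeC , c') →
             Reach c' t io d → Reach c (suc t) io d
    stepIO : ∀ {c c' d t io} → state c ≢ qf → step c ≡ (ioC , c') →
             Reach c' t io d → Reach c t (suc io) d

  inputTape : List (Fin s) → ℕ → Fin nΓ
  inputTape [] i = blank
  inputTape (a ∷ x) zero = sym a
  inputTape (a ∷ x) (suc i) = inputTape x i

  Outputs : (ℕ → Fin nΓ) → List (Fin s) → Set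
  Outputs e y = (∀ (i : Fin (length y)) → e (toℕ i) ≡ sym (lookup y i))
              × e (length y) ≡ blank

module _ {s m : ℕ} (𝓜 : TLM s (suc m)) where
  open TLM 𝓜

  initial : List (Fin s) → Conf 𝓜
  initial x = record { state = q₀
                     ; mem = replicate _ blank
                     ; head = zero
                     ; atape = ⟨ [] , false , [] ⟩
                     ; ext = inputTape 𝓜 x }

  ComputesIn : (List (Fin s) → List (Fin s)) → (ℕ → ℕ) → (ℕ → ℕ) → Set
  ComputesIn f T IO =
    Σ ℕ λ k → Σ ℕ λ N → ∀ (x : List (Fin s)) →
      Σ ℕ λ t → Σ ℕ λ io → Σ (Conf 𝓜) λ d →
        Reach 𝓜 (initial x) t io d × state d ≡ qf × Outputs 𝓜 (ext d) (f x)
        × (N ≤ length x → t ≤ k * T (length x) × io ≤ k * IO (length x))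

{-# OPTIONS --safe #-}
module Submission where

-- The one-cell machine keeps the whole main memory of 𝓜, its head position and its state
-- in its finite control, and shares the address and external tapes with 𝓜.  An ordinary
-- step of 𝓜 becomes one ordinary step.  A maximal run of Read/Write operations of 𝓜 does
-- not touch the address tape, so it accesses a single external cell; it is executed
-- symbolically in the control, recording for every cell which original cell (main memory
-- or the external one) its content comes from, and is then replaced by at most one Read,
-- one ordinary step and one Write.  Such a run is followed by an ordinary step of 𝓜 unless
-- 𝓜 halts, and a final run needs neither the Read nor the ordinary step, so both time and
-- IO at most double.  A run longer than the number of states would repeat a state and
-- never stop, so the symbolic execution needs only that much fuel.

open import Defs
open import Data.Bool using (Bool; true; false)
open import Data.Empty using (⊥-elim)
open import Data.Fin using (Fin; zero; suc; toℕ; combine; remQuot; splitAt; _↑ˡ_; _↑ʳ_)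
open import Data.Fin.Properties using (_≟_; pigeonhole; toℕ<n; remQuot-combine; splitAt-↑ˡ; splitAt-↑ʳ)
open import Data.List using (List; []; _∷_; length)
open import Data.Maybe using (Maybe; just; nothing; fromMaybe; maybe′)
import Data.Maybe as Maybe
open import Data.Nat using (ℕ; zero; suc; _+_; _*_; _∸_; _≤_; _<_; z≤n; s≤s; _<?_; _≡ᵇ_)
open import Data.Nat.GeneralisedArithmetic using (iterate)
open import Data.Nat.Properties
  using (≤-trans; ≤-refl; ≤-reflexive; ≤-pred; <⇒≤; ≮⇒≥; n<1+n; m≤n+m; +-mono-≤; +-monoˡ-<;
         *-monoʳ-≤; *-suc; *-assoc; *-distribˡ-+; +-identityʳ; m+[n∸m]≡n)
open import Data.Product using (Σ; _×_; _,_; proj₁; proj₂; map₂)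
open import Data.Sum using (_⊎_; inj₁; inj₂)
open import Data.Unit using (⊤; tt)
open import Data.Vec using (Vec; []; _∷_; map; tabulate; replicate; lookup; _[_]≔_)
open import Data.Vec.Properties
  using (lookup∘update; lookup-map; lookup-replicate; map-[]≔; map-∘; map-cong; tabulate-∘; tabulate∘lookup)
open import Function using (_∘_)
open import Relation.Binary.PropositionalEquality
  using (_≡_; _≢_; refl; sym; trans; cong; cong₂; subst; _≗_; module ≡-Reasoning)
open import Relation.Nullary using (¬_; Dec; yes; no)
open import Relation.Nullary.Decidable using (_⊎-dec_)

record Finite (A : Set) : Set where
  field
    size          : ℕ
    encode        : A → Fin size
    decode        : Fin size → A
    decode-encode : ∀ a → decode (encode a) ≡ a

  encode-injective : ∀ {a b} → encode a ≡ encode b → a ≡ b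
  encode-injective {a} {b} e = trans (sym (decode-encode a)) (trans (cong decode e) (decode-encode b))

finite-Fin : ∀ n → Finite (Fin n)
finite-Fin n = record { size = n ; encode = λ i → i ; decode = λ i → i ; decode-encode = λ _ → refl }

finite-⊤ : Finite ⊤
finite-⊤ = record { size = 1 ; encode = λ _ → zero ; decode = λ _ → tt ; decode-encode = λ _ → refl }

finite-retract : ∀ {A B} → Finite B → (f : A → B) (g : B → A) → (∀ a → g (f a) ≡ a) → Finite A
finite-retract FB f g gf = record
  { size = size ; encode = encode ∘ f ; decode = g ∘ decode
  ; decode-encode = λ a → trans (cong g (decode-encode (f a))) (gf a) }
  where open Finite FB

finite-× : ∀ {A B} → Finite A → Finite B → Finite (A × B)
finite-× {A} {B} FA FB = record
  { size = FA.size * FB.size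
  ; encode = λ (a , b) → combine (FA.encode a) (FB.encode b)
  ; decode = decode-pair ∘ remQuot FB.size
  ; decode-encode = λ (a , b) → trans
      (cong decode-pair (remQuot-combine (FA.encode a) (FB.encode b)))
      (cong₂ _,_ (FA.decode-encode a) (FB.decode-encode b)) }
  where
  module FA = Finite FA
  module FB = Finite FB
  decode-pair : Fin FA.size × Fin FB.size → A × B
  decode-pair (i , j) = FA.decode i , FB.decode j

finite-⊎ : ∀ {A B} → Finite A → Finite B → Finite (A ⊎ B)
finite-⊎ {A} {B} FA FB = record
  { size = FA.size + FB.size ; encode = encode-sum ; decode = decode-sum ∘ splitAt FA.size
  ; decode-encode = decode-encode-sum }
  where
  module FA = Finite FA
  module FB = Finite FB
  encode-sum : A ⊎ B → Fin (FA.size + FB.size)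
  encode-sum (inj₁ a) = FA.encode a ↑ˡ FB.size
  encode-sum (inj₂ b) = FA.size ↑ʳ FB.encode b
  decode-sum : Fin FA.size ⊎ Fin FB.size → A ⊎ B
  decode-sum (inj₁ i) = inj₁ (FA.decode i)
  decode-sum (inj₂ j) = inj₂ (FB.decode j)
  decode-encode-sum : ∀ x → decode-sum (splitAt FA.size (encode-sum x)) ≡ x
  decode-encode-sum (inj₁ a)
    rewrite splitAt-↑ˡ FA.size (FA.encode a) FB.size | FA.decode-encode a = refl
  decode-encode-sum (inj₂ b)
    rewrite splitAt-↑ʳ FA.size FB.size (FB.encode b) | FB.decode-encode b = refl

finite-Maybe : ∀ {A} → Finite A → Finite (Maybe A)
finite-Maybe FA = finite-retract (finite-⊎ finite-⊤ FA)
  (λ { nothing → inj₁ tt ; (just a) → inj₂ a })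
  (λ { (inj₁ _) → nothing ; (inj₂ a) → just a })
  (λ { nothing → refl ; (just a) → refl })

finite-Vec : ∀ {A} → Finite A → ∀ n → Finite (Vec A n)
finite-Vec FA zero = finite-retract finite-⊤ (λ _ → tt) (λ _ → []) (λ { [] → refl })
finite-Vec FA (suc n) = finite-retract (finite-× FA (finite-Vec FA n))
  (λ { (x ∷ xs) → x , xs }) (λ (x , xs) → x ∷ xs) (λ { (x ∷ xs) → refl })

module _ {A : Set} where

  update-same : ∀ (g : ℕ → A) k a → update g k a k ≡ a
  update-same g zero a = refl
  update-same g (suc k) a = update-same (g ∘ suc) k a

  update-id : ∀ (g : ℕ → A) k → update g k (g k) ≗ g
  update-id g zero zero = refl
  update-id g zero (suc i) = refl
  update-id g (suc k) zero = refl
  update-id g (suc k) (suc i) = update-id (g ∘ suc) k i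

  update-cong : ∀ {g g′ : ℕ → A} k a → g ≗ g′ → update g k a ≗ update g′ k a
  update-cong k a g≗g′ i with i ≡ᵇ k
  ... | true = refl
  ... | false = g≗g′ i

  update-update : ∀ (g : ℕ → A) k a b → update (update g k a) k b ≗ update g k b
  update-update g k a b i with i ≡ᵇ k
  ... | true = refl
  ... | false = refl

  update-absorb : ∀ {g g₀ : ℕ → A} k a b → g ≗ update g₀ k a → update g k b ≗ update g₀ k b
  update-absorb {g₀ = g₀} k a b g≗ i = trans (update-cong k b g≗ i) (update-update g₀ k a b i)

iterate-+ : ∀ {A : Set} (f : A → A) x m n → iterate f x (m + n) ≡ iterate f (iterate f x m) n
iterate-+ f x zero n = refl
iterate-+ f x (suc m) n = iterate-+ f (f x) m n

-- If the orbit of x under f first meets P at step j, its points up to step j are pairwise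
-- distinct (a repetition would make the orbit periodic and meet P earlier), so j < n.
first-hit-< : ∀ {n} (f : Fin n → Fin n) (P : Fin n → Set) x j →
              (∀ i → i < j → ¬ P (iterate f x i)) → P (iterate f x j) → j < n
first-hit-< {n} f P x j miss hit with j <? n
... | yes j<n = j<n
... | no j≮n with pigeonhole (n<1+n n) (λ k → iterate f x (toℕ k))
... | a , b , a<b , same = ⊥-elim (miss (toℕ a + (j ∸ toℕ b)) earlier (subst P (sym cycle) hit))
  where
  open ≡-Reasoning
  b≤j : toℕ b ≤ j
  b≤j = ≤-trans (≤-pred (toℕ<n b)) (≮⇒≥ j≮n)
  cycle : iterate f x (toℕ a + (j ∸ toℕ b)) ≡ iterate f x j
  cycle = begin
    iterate f x (toℕ a + (j ∸ toℕ b))          ≡⟨ iterate-+ f x (toℕ a) (j ∸ toℕ b) ⟩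
    iterate f (iterate f x (toℕ a)) (j ∸ toℕ b) ≡⟨ cong (λ y → iterate f y (j ∸ toℕ b)) same ⟩
    iterate f (iterate f x (toℕ b)) (j ∸ toℕ b) ≡⟨ iterate-+ f x (toℕ b) (j ∸ toℕ b) ⟨
    iterate f x (toℕ b + (j ∸ toℕ b))          ≡⟨ cong (iterate f x) (m+[n∸m]≡n b≤j) ⟩
    iterate f x j                              ∎
  earlier : toℕ a + (j ∸ toℕ b) < j
  earlier = subst (toℕ a + (j ∸ toℕ b) <_) (m+[n∸m]≡n b≤j) (+-monoˡ-< (j ∸ toℕ b) a<b)

module _ {s M : ℕ} (𝓝 : TLM s M) where

  reach-trans : ∀ {c d e t₁ io₁ t₂ io₂} → Reach 𝓝 c t₁ io₁ d → Reach 𝓝 d t₂ io₂ e →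
                Reach 𝓝 c (t₁ + t₂) (io₁ + io₂) e
  reach-trans done r = r
  reach-trans (stepT ne st r₁) r = stepT ne st (reach-trans r₁ r)
  reach-trans (stepIO ne st r₁) r = stepIO ne st (reach-trans r₁ r)

  record Within (P : Conf 𝓝 → Set) (c : Conf 𝓝) (t io : ℕ) : Set where
    constructor within
    field
      t′ io′ : ℕ
      d      : Conf 𝓝
      run    : Reach 𝓝 c t′ io′ d
      holds  : P d
      t′≤    : t′ ≤ t
      io′≤   : io′ ≤ io

  within-here : ∀ {P c} → P c → Within P c 0 0
  within-here p = within 0 0 _ done p z≤n z≤n

  within-stepT : ∀ {P c c₁ t io} → state c ≢ TLM.qf 𝓝 → step 𝓝 c ≡ (timeC , c₁) →
                 Within P c₁ t io → Within P c (suc t) io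
  within-stepT ne st (within t′ io′ d r p t′≤ io′≤) = within (suc t′) io′ d (stepT ne st r) p (s≤s t′≤) io′≤

  within-stepIO : ∀ {P c c₁ t io} → state c ≢ TLM.qf 𝓝 → step 𝓝 c ≡ (ioC , c₁) →
                  Within P c₁ t io → Within P c t (suc io)
  within-stepIO ne st (within t′ io′ d r p t′≤ io′≤) = within t′ (suc io′) d (stepIO ne st r) p t′≤ (s≤s io′≤)

  within-bind : ∀ {P Q c t₁ io₁ t₂ io₂} → Within Q c t₁ io₁ → (∀ {c₁} → Q c₁ → Within P c₁ t₂ io₂) →
                Within P c (t₁ + t₂) (io₁ + io₂)
  within-bind (within t′ io′ d r q t′≤ io′≤) k with k q
  ... | within t″ io″ e r′ p t″≤ io″≤ =
    within (t′ + t″) (io′ + io″) e (reach-trans r r′) p (+-mono-≤ t′≤ t″≤) (+-mono-≤ io′≤ io″≤)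

  within-weaken : ∀ {P c t io t₂ io₂} → t ≤ t₂ → io ≤ io₂ → Within P c t io → Within P c t₂ io₂
  within-weaken t≤ io≤ (within t′ io′ d r p t′≤ io′≤) = within t′ io′ d r p (≤-trans t′≤ t≤) (≤-trans io′≤ io≤)

module OneCellSimulation {s m : ℕ} (𝓜 : TLM s (suc m)) where
  open TLM 𝓜 hiding (sym)

  C : Set
  C = Conf 𝓜

  afterNormal afterRead afterWrite : C → C
  afterNormal c = proj₂ (stepK 𝓜 normal c)
  afterRead c = proj₂ (stepK 𝓜 readK c)
  afterWrite c = proj₂ (stepK 𝓜 writeK c)

  ioSucc : Fin nQ → Fin nQ
  ioSucc q = proj₁ (ioNext q)

  ioMove : Fin nQ → Move
  ioMove q = proj₂ (ioNext q)

  data IOStep (c : C) : C → Set where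
    read  : kind (state c) ≡ readK → IOStep c (afterRead c)
    write : kind (state c) ≡ writeK → IOStep c (afterWrite c)

  io-step-view : ∀ {c c′} → step 𝓜 c ≡ (ioC , c′) → IOStep c c′
  io-step-view {c} st with kind (state c) in k
  io-step-view refl | readK = read k
  io-step-view refl | writeK = write k

  normal-step-view : ∀ {c c′} → step 𝓜 c ≡ (timeC , c′) → kind (state c) ≡ normal × c′ ≡ afterNormal c
  normal-step-view {c} st with kind (state c)
  normal-step-view refl | normal = refl , refl

  Stopped : Fin nQ → Set
  Stopped q = q ≡ qf ⊎ kind q ≡ normal

  io-step-unstopped : ∀ {c c′} → state c ≢ qf → IOStep c c′ → ¬ Stopped (state c)
  io-step-unstopped ne _ (inj₁ final) = ne final
  io-step-unstopped _ (read k) (inj₂ n) with () ← trans (sym k) n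
  io-step-unstopped _ (write k) (inj₂ n) with () ← trans (sym k) n

  io-step-state : ∀ {c c′} → IOStep c c′ → state c′ ≡ ioSucc (state c)
  io-step-state (read _) = refl
  io-step-state (write _) = refl

  record IOPrefix (c : C) (t io : ℕ) (d : C) : Set where
    constructor io-prefix
    field
      j io₁   : ℕ
      ce      : C
      run     : Reach 𝓜 c 0 j ce
      stopped : Stopped (state ce)
      rest    : Reach 𝓜 ce t io₁ d
      io≡     : io ≡ j + io₁

  split-io-prefix : ∀ {c t io d} → Reach 𝓜 c t io d → state d ≡ qf → IOPrefix c t io d
  split-io-prefix {c} done hd = io-prefix 0 0 c done (inj₁ hd) done refl
  split-io-prefix {c} r@(stepT _ st _) _ = io-prefix 0 _ c done (inj₂ (proj₁ (normal-step-view st))) r refl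
  split-io-prefix (stepIO ne st r) hd with split-io-prefix r hd
  ... | io-prefix j io₁ ce run stp rest refl = io-prefix (suc j) io₁ ce (stepIO ne st run) stp rest refl

  io-run-orbit : ∀ {c j ce} → Reach 𝓜 c 0 j ce →
                 state ce ≡ iterate ioSucc (state c) j × (∀ i → i < j → ¬ Stopped (iterate ioSucc (state c) i))
  io-run-orbit done = refl , λ _ ()
  io-run-orbit {c} {suc j} {ce} (stepIO ne st r) with io-step-view st | io-run-orbit r
  ... | v | at-end , before =
    subst (λ q → state ce ≡ iterate ioSucc q j) (io-step-state v) at-end ,
    λ { zero _ → io-step-unstopped ne v
      ; (suc i) (s≤s i<j) → subst (λ q → ¬ Stopped (iterate ioSucc q i)) (io-step-state v) (before i i<j) }

  io-run-short : ∀ {c j ce} → Reach 𝓜 c 0 j ce → Stopped (state ce) → j < nQ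
  io-run-short {c} {j} r stp =
    first-hit-< ioSucc Stopped (state c) j (proj₂ (io-run-orbit r)) (subst Stopped (proj₁ (io-run-orbit r)) stp)

  halted-reach : ∀ {c t io d} → Reach 𝓜 c t io d → state c ≡ qf → t ≡ 0 × io ≡ 0 × c ≡ d
  halted-reach done _ = refl , refl , refl
  halted-reach (stepT ne _ _) hc = ⊥-elim (ne hc)
  halted-reach (stepIO ne _ _) hc = ⊥-elim (ne hc)

  normal-start : ∀ {c t io d} → Reach 𝓜 c t io d → state d ≡ qf → state c ≢ qf → kind (state c) ≡ normal →
                 Σ ℕ λ t₁ → t ≡ suc t₁ × Reach 𝓜 (afterNormal c) t₁ io d
  normal-start done hd ne _ = ⊥-elim (ne hd)
  normal-start (stepT _ st r) _ _ _ with refl ← proj₂ (normal-step-view st) = _ , refl , r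
  normal-start (stepIO _ st _) _ _ n with io-step-view st
  ... | read k with () ← trans (sym n) k
  ... | write k with () ← trans (sym n) k

  -- Symbolic contents during a run of Read/Write operations: just j stands for main memory
  -- cell j and nothing for the external cell at the (fixed) current address, both as they
  -- were when the run started.
  Loc : Set
  Loc = Maybe (Fin (suc m))

  record Sym : Set where
    constructor mkSym
    field
      symState : Fin nQ
      symHead  : Fin (suc m)
      symMem   : Vec Loc (suc m)
      symExt   : Loc
  open Sym

  symStart : Fin nQ → Fin (suc m) → Sym
  symStart q h = mkSym q h (tabulate just) nothing

  symStep : Kind → Sym → Sym
  symStep normal σ = σ
  symStep readK (mkSym q h cs e) = mkSym (ioSucc q) (moveH (ioMove q) h) (cs [ h ]≔ e) e
  symStep writeK (mkSym q h cs e) = mkSym (ioSucc q) (moveH (ioMove q) h) cs (lookup cs h)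

  normal? : ∀ k → Dec (k ≡ normal)
  normal? normal = yes refl
  normal? readK = no λ ()
  normal? writeK = no λ ()

  stopped? : ∀ q → Dec (Stopped q)
  stopped? q = (q ≟ qf) ⊎-dec normal? (kind q)

  runSym : ℕ → Sym → Maybe (Sym × ℕ)
  runSym fuel σ with stopped? (symState σ)
  ... | yes _ = just (σ , 0)
  runSym zero σ | no _ = nothing
  runSym (suc fuel) σ | no _ = Maybe.map (map₂ suc) (runSym fuel (symStep (kind (symState σ)) σ))

  runSym-stopped : ∀ fuel σ → Stopped (symState σ) → runSym fuel σ ≡ just (σ , 0)
  runSym-stopped fuel σ stp with stopped? (symState σ)
  ... | yes _ = refl
  ... | no ¬stp = ⊥-elim (¬stp stp)

  runSym-running : ∀ fuel σ → ¬ Stopped (symState σ) →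
                   runSym (suc fuel) σ ≡ Maybe.map (map₂ suc) (runSym fuel (symStep (kind (symState σ)) σ))
  runSym-running fuel σ ¬stp with stopped? (symState σ)
  ... | yes stp = ⊥-elim (¬stp stp)
  ... | no _ = refl

  addr : C → ℕ
  addr c = address (atape c)

  contents : C → Loc → Fin nΓ
  contents c₀ = maybe′ (lookup (mem c₀)) (ext c₀ (addr c₀))

  record Describes (c₀ : C) (σ : Sym) (c : C) : Set where
    constructor describes
    field
      state≡ : state c ≡ symState σ
      head≡  : head c ≡ symHead σ
      atape≡ : atape c ≡ atape c₀
      mem≡   : mem c ≡ map (contents c₀) (symMem σ)
      ext≗   : ext c ≗ update (ext c₀) (addr c₀) (contents c₀ (symExt σ))

  describes-start : ∀ c → Describes c (symStart (state c) (head c)) c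
  describes-start c = describes refl refl refl
    (trans (sym (tabulate∘lookup (mem c))) (tabulate-∘ (contents c) just))
    (λ i → sym (update-id (ext c) (addr c) i))

  describes-read : ∀ {c₀ σ c} → Describes c₀ σ c → Describes c₀ (symStep readK σ) (afterRead c)
  describes-read {c₀} {mkSym q h cs e} {c} (describes refl refl refl refl ext≗) =
    describes refl refl refl
      (trans (cong (map (contents c₀) cs [ h ]≔_) read-value) (sym (map-[]≔ (contents c₀) cs h)))
      ext≗
    where
    read-value : ext c (addr c₀) ≡ contents c₀ e
    read-value = trans (ext≗ (addr c₀)) (update-same (ext c₀) (addr c₀) (contents c₀ e))

  describes-write : ∀ {c₀ σ c} → Describes c₀ σ c → Describes c₀ (symStep writeK σ) (afterWrite c)
  describes-write {c₀} {mkSym q h cs e} {c} (describes refl refl refl refl ext≗) =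
    describes refl refl refl refl λ i →
      trans (cong (λ v → update (ext c) (addr c₀) v i) (lookup-map h (contents c₀) cs))
            (update-absorb (addr c₀) (contents c₀ e) _ ext≗ i)

  describes-io : ∀ {c₀ σ c c′} → Describes c₀ σ c → step 𝓜 c ≡ (ioC , c′) →
                 Describes c₀ (symStep (kind (symState σ)) σ) c′
  describes-io D st with io-step-view st
  ... | read k rewrite sym (Describes.state≡ D) | k = describes-read D
  ... | write k rewrite sym (Describes.state≡ D) | k = describes-write D

  runSym-correct : ∀ {c₀ σ c j ce} fuel → Describes c₀ σ c → Reach 𝓜 c 0 j ce → Stopped (state ce) → j ≤ fuel →
                   Σ Sym λ se → runSym fuel σ ≡ just (se , j) × Describes c₀ se ce × (j ≡ 0 → se ≡ σ)
  runSym-correct {σ = σ} fuel D done stp _ =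
    σ , runSym-stopped fuel σ (subst Stopped (Describes.state≡ D) stp) , D , λ _ → refl
  runSym-correct {σ = σ} (suc fuel) D (stepIO ne st r) stp (s≤s j≤fuel)
    with runSym-correct fuel (describes-io D st) r stp j≤fuel
  ... | se , runs , D′ , _ =
    se , trans (runSym-running fuel σ running) (cong (Maybe.map (map₂ suc)) runs) , D′ , λ ()
    where
    running : ¬ Stopped (symState σ)
    running = subst (¬_ ∘ Stopped) (Describes.state≡ D) (io-step-unstopped ne (io-step-view st))

  -- execute q mm h simulates an ordinary step of 𝓜 in state q with memory mm and head h.
  -- A run of Read/Write operations is replaced by the Read fetch, the ordinary step absorb
  -- (which stores the fetched value into the memory held in the state) and the Write store;
  -- diverged is entered when the run never stops.
  data Control : Set where
    halted diverged : Control
    writeThenHalt   : Fin nΓ → Control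
    fetch absorb    : Fin nQ → Vec (Maybe (Fin nΓ)) (suc m) → Fin (suc m) → Maybe (Fin nΓ) → Control
    store execute   : Fin nQ → Vec (Fin nΓ) (suc m) → Fin (suc m) → Control

  haltWith : Maybe (Fin nΓ) → Control
  haltWith nothing = halted
  haltWith (just a) = writeThenHalt a

  continue : Vec (Fin nΓ) (suc m) → Sym → ℕ → Control
  continue mm σ zero = execute (symState σ) mm (symHead σ)
  continue mm σ (suc _) =
    fetch (symState σ) (map (Maybe.map (lookup mm)) (symMem σ)) (symHead σ) (Maybe.map (lookup mm) (symExt σ))

  resume : Vec (Fin nΓ) (suc m) → Sym → ℕ → Control
  resume mm σ j with symState σ ≟ qf
  ... | yes _ = haltWith (Maybe.map (lookup mm) (symExt σ))
  ... | no _ = continue mm σ j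

  entryAfter : Vec (Fin nΓ) (suc m) → Maybe (Sym × ℕ) → Control
  entryAfter mm nothing = diverged
  entryAfter mm (just (σ , j)) = resume mm σ j

  enter : Fin nQ → Vec (Fin nΓ) (suc m) → Fin (suc m) → Control
  enter q mm h = entryAfter mm (runSym nQ (symStart q h))

  -- The value a final Write needs is put into the main memory cell by the ordinary step
  -- that enters writeThenHalt, so that halting costs no ordinary step.
  preload : Control → Fin nΓ
  preload (writeThenHalt a) = a
  preload _ = blank

  kindC : Control → Kind
  kindC (writeThenHalt _) = writeK
  kindC (fetch _ _ _ _) = readK
  kindC (store _ _ _) = writeK
  kindC _ = normal

  ioNextC : Control → Control
  ioNextC (fetch q cs h e) = absorb q cs h e
  ioNextC (store q mm h) = execute q mm h
  ioNextC _ = halted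

  absorbNext : Fin nQ → Vec (Fin nΓ) (suc m) → Fin (suc m) → Fin nΓ → Maybe (Fin nΓ) → Control × Fin nΓ
  absorbNext q mm h a (just v) = store q mm h , v
  absorbNext q mm h a nothing = execute q mm h , a

  δC : Control → Fin nΓ → Bool → Control × Fin nΓ × Move × Bool × Move
  δC (absorb q cs h e) a b =
    let (d , v) = absorbNext q (map (fromMaybe a) cs) h a e in d , v , S , b , S
  δC (execute q mm h) _ b =
    let (q′ , v , mv , b′ , amv) = δ q (lookup mm h) b
        d = enter q′ (mm [ h ]≔ v) (moveH mv h)
    in d , preload d , S , b′ , amv
  δC d a b = d , a , S , b , S

  Pending Snapshot : Set
  Pending = Fin nQ × Vec (Maybe (Fin nΓ)) (suc m) × Fin (suc m) × Maybe (Fin nΓ)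
  Snapshot = Fin nQ × Vec (Fin nΓ) (suc m) × Fin (suc m)

  ControlCode : Set
  ControlCode = ⊤ ⊎ ⊤ ⊎ Fin nΓ ⊎ Pending ⊎ Pending ⊎ Snapshot ⊎ Snapshot

  toCode : Control → ControlCode
  toCode halted = inj₁ tt
  toCode diverged = inj₂ (inj₁ tt)
  toCode (writeThenHalt a) = inj₂ (inj₂ (inj₁ a))
  toCode (fetch q cs h e) = inj₂ (inj₂ (inj₂ (inj₁ (q , cs , h , e))))
  toCode (absorb q cs h e) = inj₂ (inj₂ (inj₂ (inj₂ (inj₁ (q , cs , h , e)))))
  toCode (store q mm h) = inj₂ (inj₂ (inj₂ (inj₂ (inj₂ (inj₁ (q , mm , h))))))
  toCode (execute q mm h) = inj₂ (inj₂ (inj₂ (inj₂ (inj₂ (inj₂ (q , mm , h))))))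

  fromCode : ControlCode → Control
  fromCode (inj₁ tt) = halted
  fromCode (inj₂ (inj₁ tt)) = diverged
  fromCode (inj₂ (inj₂ (inj₁ a))) = writeThenHalt a
  fromCode (inj₂ (inj₂ (inj₂ (inj₁ (q , cs , h , e))))) = fetch q cs h e
  fromCode (inj₂ (inj₂ (inj₂ (inj₂ (inj₁ (q , cs , h , e)))))) = absorb q cs h e
  fromCode (inj₂ (inj₂ (inj₂ (inj₂ (inj₂ (inj₁ (q , mm , h))))))) = store q mm h
  fromCode (inj₂ (inj₂ (inj₂ (inj₂ (inj₂ (inj₂ (q , mm , h))))))) = execute q mm h

  fromCode-toCode : ∀ d → fromCode (toCode d) ≡ d
  fromCode-toCode halted = refl
  fromCode-toCode diverged = refl
  fromCode-toCode (writeThenHalt _) = refl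
  fromCode-toCode (fetch _ _ _ _) = refl
  fromCode-toCode (absorb _ _ _ _) = refl
  fromCode-toCode (store _ _ _) = refl
  fromCode-toCode (execute _ _ _) = refl

  finite-Pending : Finite Pending
  finite-Pending = finite-× (finite-Fin nQ) (finite-× (finite-Vec (finite-Maybe (finite-Fin nΓ)) (suc m))
                     (finite-× (finite-Fin (suc m)) (finite-Maybe (finite-Fin nΓ))))

  finite-Snapshot : Finite Snapshot
  finite-Snapshot = finite-× (finite-Fin nQ) (finite-× (finite-Vec (finite-Fin nΓ) (suc m)) (finite-Fin (suc m)))

  -- Kept abstract so that decode never unfolds; only decode-encode is used.
  abstract
    finite-Control : Finite Control
    finite-Control = finite-retract
      (finite-⊎ finite-⊤ (finite-⊎ finite-⊤ (finite-⊎ (finite-Fin nΓ)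
        (finite-⊎ finite-Pending (finite-⊎ finite-Pending (finite-⊎ finite-Snapshot finite-Snapshot))))))
      toCode fromCode fromCode-toCode

  open Finite finite-Control using (encode; decode; decode-encode; encode-injective)

  𝓜′ : TLM s 1
  𝓜′ = record
    { nQ = Finite.size finite-Control ; nΓ = nΓ ; blank = blank
    ; sym = TLM.sym 𝓜 ; sym-inj = sym-inj ; blank∉Σ = blank∉Σ
    ; δ = λ i a b → let (d , r) = δC (decode i) a b in encode d , r
    ; kind = kindC ∘ decode
    ; ioNext = λ i → encode (ioNextC (decode i)) , S
    ; q₀ = encode (enter q₀ (replicate (suc m) blank) zero)
    ; qf = encode halted }

  C′ : Set
  C′ = Conf 𝓜′

  phys : C′ → Fin nΓ
  phys c′ = lookup (mem c′) (head c′)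

  normal′ : Control → C′ → C′
  normal′ d c′ = record
    { state = encode (proj₁ r)
    ; mem = mem c′ [ head c′ ]≔ proj₁ (proj₂ r)
    ; head = moveH (proj₁ (proj₂ (proj₂ r))) (head c′)
    ; atape = moveA (proj₂ (proj₂ (proj₂ (proj₂ r)))) (record (atape c′) { curA = proj₁ (proj₂ (proj₂ (proj₂ r))) })
    ; ext = ext c′ }
    where
    r : Control × Fin nΓ × Move × Bool × Move
    r = δC d (phys c′) (curA (atape c′))

  read′ write′ : Control → C′ → C′
  read′ d c′ = record c′ { state = encode (ioNextC d) ; mem = mem c′ [ head c′ ]≔ ext c′ (address (atape c′)) }
  write′ d c′ = record c′ { state = encode (ioNextC d) ; ext = update (ext c′) (address (atape c′)) (phys c′) }

  step′-normal : ∀ c′ {d} → decode (state c′) ≡ d → kindC d ≡ normal → step 𝓜′ c′ ≡ (timeC , normal′ d c′)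
  step′-normal c′ refl k = cong (λ κ → stepK 𝓜′ κ c′) k

  step′-read : ∀ c′ {d} → decode (state c′) ≡ d → kindC d ≡ readK → step 𝓜′ c′ ≡ (ioC , read′ d c′)
  step′-read c′ refl k = cong (λ κ → stepK 𝓜′ κ c′) k

  step′-write : ∀ c′ {d} → decode (state c′) ≡ d → kindC d ≡ writeK → step 𝓜′ c′ ≡ (ioC , write′ d c′)
  step′-write c′ refl k = cong (λ κ → stepK 𝓜′ κ c′) k

  decode-control : ∀ {q d} → q ≡ encode d → decode q ≡ d
  decode-control {d = d} st = trans (cong decode st) (decode-encode d)

  not-halted : ∀ {q d} → q ≡ encode d → d ≢ halted → q ≢ TLM.qf 𝓜′
  not-halted st d≢halted h = d≢halted (encode-injective (trans (sym st) h))

  record Tracks (c : C) (d : Control) (c′ : C′) : Set where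
    constructor tracks
    field
      control≡ : state c′ ≡ encode d
      atape≡′  : atape c′ ≡ atape c
      ext≗′    : ext c′ ≗ ext c

  entry : C → Control
  entry c = enter (state c) (mem c) (head c)

  record Entered (c : C) (c′ : C′) : Set where
    constructor entered
    field
      tracking  : Tracks c (entry c) c′
      preloaded : phys c′ ≡ preload (entry c)

  HaltedWith : C → C′ → Set
  HaltedWith d d′ = state d′ ≡ encode halted × ext d′ ≗ ext d

  Executing : C → C′ → Set
  Executing ce = Tracks ce (execute (state ce) (mem ce) (head ce))

  execute-step : ∀ {ce c′} → Executing ce c′ → Within 𝓜′ (Entered (afterNormal ce)) c′ 1 0
  execute-step {ce} {c′} (tracks st refl ext≗) =
    within-stepT 𝓜′ (not-halted st λ ()) (step′-normal c′ (decode-control st) refl)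
      (within-here 𝓜′ (entered (tracks refl refl ext≗) (lookup∘update (head c′) (mem c′) _)))

  ext-untouched : ∀ {g c q h cs ce} → g ≗ ext c → Describes c (mkSym q h cs nothing) ce → g ≗ ext ce
  ext-untouched {c = c} ext≗ D i = trans (ext≗ i) (trans (sym (update-id (ext c) (addr c) i)) (sym (Describes.ext≗ D i)))

  ext-written : ∀ {g c q h cs j ce} → g ≗ ext c → Describes c (mkSym q h cs (just j)) ce →
                update g (addr c) (lookup (mem c) j) ≗ ext ce
  ext-written {c = c} ext≗ D i = trans (update-cong (addr c) _ ext≗ i) (sym (Describes.ext≗ D i))

  absorbed-memory : ∀ c {a} (cs : Vec Loc (suc m)) → a ≡ ext c (addr c) →
                    map (fromMaybe a) (map (Maybe.map (lookup (mem c))) cs) ≡ map (contents c) cs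
  absorbed-memory c cs refl = trans (sym (map-∘ _ _ cs)) (map-cong (λ { (just _) → refl ; nothing → refl }) cs)

  absorb-path : ∀ {c c₁ q h cs e ce} →
                Tracks c (absorb q (map (Maybe.map (lookup (mem c))) cs) h (Maybe.map (lookup (mem c)) e)) c₁ →
                phys c₁ ≡ ext c (addr c) → Describes c (mkSym q h cs e) ce → Within 𝓜′ (Executing ce) c₁ 1 1
  absorb-path {c} {c₁} {q} {h} {cs} {nothing} (tracks st refl ext≗) fetched D@(describes refl refl refl refl _) =
    within-weaken 𝓜′ ≤-refl z≤n
      (within-stepT 𝓜′ (not-halted st λ ()) (step′-normal c₁ (decode-control st) refl)
        (within-here 𝓜′ (tracks (cong (λ mm → encode (execute q mm h)) (absorbed-memory c cs fetched)) refl
          (ext-untouched ext≗ D))))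
  absorb-path {c} {c₁} {q} {h} {cs} {just j} (tracks st refl ext≗) fetched D@(describes refl refl refl refl _) =
    within-stepT 𝓜′ (not-halted st λ ()) (step′-normal c₁ (decode-control st) refl)
      (within-stepIO 𝓜′ (not-halted refl λ ()) (step′-write _ (decode-encode _) refl)
        (within-here 𝓜′ (tracks (cong (λ mm → encode (execute q mm h)) (absorbed-memory c cs fetched)) refl
          λ i → trans (cong (λ v → update (ext c₁) (addr c) v i) (lookup∘update (head c₁) (mem c₁) _))
                      (ext-written ext≗ D i))))

  fetch-path : ∀ {c c′ q h cs e ce} →
               Tracks c (fetch q (map (Maybe.map (lookup (mem c))) cs) h (Maybe.map (lookup (mem c)) e)) c′ →
               Describes c (mkSym q h cs e) ce → Within 𝓜′ (Executing ce) c′ 1 2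
  fetch-path {c} {c′} (tracks st refl ext≗) D =
    within-stepIO 𝓜′ (not-halted st λ ()) (step′-read c′ (decode-control st) refl)
      (absorb-path (tracks refl refl ext≗) (trans (lookup∘update (head c′) (mem c′) _) (ext≗ (addr c))) D)

  pause-to-execute : ∀ {c c′ se j ce} → Entered c c′ → entry c ≡ continue (mem c) se j → Describes c se ce →
                     (j ≡ 0 → se ≡ symStart (state c) (head c)) → Within 𝓜′ (Executing ce) c′ 1 (2 * j)
  pause-to-execute {c} {c′} {j = zero} (entered (tracks st refl ext≗) _) entry≡ D@(describes refl refl refl refl _)
    unchanged with refl ← unchanged refl =
    within-weaken 𝓜′ z≤n z≤n (within-here 𝓜′ (tracks control refl (ext-untouched ext≗ D)))
    where
    control : state c′ ≡ encode (execute (state c) (map (contents c) (tabulate just)) (head c))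
    control = trans st (cong encode (trans entry≡
                (cong (λ mm → execute (state c) mm (head c)) (Describes.mem≡ (describes-start c)))))
  pause-to-execute {se = mkSym q h cs e} {suc j} (entered (tracks st refl ext≗) _) entry≡ D _ =
    within-weaken 𝓜′ ≤-refl (*-monoʳ-≤ 2 (s≤s (z≤n {j})))
      (fetch-path (tracks (trans st (cong encode entry≡)) refl ext≗) D)

  finish-halted : ∀ {c c′ se j ce} → Entered c c′ → entry c ≡ haltWith (Maybe.map (lookup (mem c)) (symExt se)) →
                  Describes c se ce → (j ≡ 0 → se ≡ symStart (state c) (head c)) → Within 𝓜′ (HaltedWith ce) c′ 0 (2 * j)
  finish-halted {se = mkSym q h cs nothing} (entered (tracks st refl ext≗) _) entry≡ D _ =
    within-weaken 𝓜′ z≤n z≤n (within-here 𝓜′ (trans st (cong encode entry≡) , ext-untouched ext≗ D))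
  finish-halted {se = mkSym q h cs (just jj)} {zero} _ _ _ unchanged with () ← unchanged refl
  finish-halted {c} {c′} {mkSym q h cs (just jj)} {suc j} (entered (tracks st refl ext≗) preloaded) entry≡ D _ =
    within-weaken 𝓜′ z≤n (s≤s z≤n)
      (within-stepIO 𝓜′ (not-halted st′ λ ()) (step′-write c′ (decode-control st′) refl) (within-here 𝓜′ (refl ,
        λ i → trans (cong (λ v → update (ext c′) (addr c) v i) (trans preloaded (cong preload entry≡)))
                    (ext-written ext≗ D i))))
    where
    st′ : state c′ ≡ encode (writeThenHalt (lookup (mem c) jj))
    st′ = trans st (cong encode entry≡)

  resume-halted : ∀ mm σ j → symState σ ≡ qf → resume mm σ j ≡ haltWith (Maybe.map (lookup mm) (symExt σ))
  resume-halted mm σ j final with symState σ ≟ qf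
  ... | yes _ = refl
  ... | no running = ⊥-elim (running final)

  resume-paused : ∀ mm σ j → symState σ ≢ qf → resume mm σ j ≡ continue mm σ j
  resume-paused mm σ j running with symState σ ≟ qf
  ... | yes final = ⊥-elim (running final)
  ... | no _ = refl

  stopped-normal : ∀ {q} → Stopped q → q ≢ qf → kind q ≡ normal
  stopped-normal (inj₁ final) running = ⊥-elim (running final)
  stopped-normal (inj₂ n) _ = n

  Simulation : ℕ → Set
  Simulation t = ∀ {c io d c′} → Reach 𝓜 c t io d → state d ≡ qf → Entered c c′ →
                 Within 𝓜′ (HaltedWith d) c′ (2 * t) (2 * io)

  simulation-step : ∀ t → (∀ {t₁} → t ≡ suc t₁ → Simulation t₁) → Simulation t
  simulation-step t ih {c} r hd E with split-io-prefix r hd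
  ... | io-prefix j io₁ ce run stp rest refl
    with runSym-correct nQ (describes-start c) run stp (<⇒≤ (io-run-short run stp))
  ... | se , runs , D , unchanged with symState se ≟ qf
  ... | yes final with halted-reach rest (trans (Describes.state≡ D) final)
  ...   | refl , refl , refl =
    within-weaken 𝓜′ z≤n (≤-reflexive (cong (2 *_) (sym (+-identityʳ j))))
      (finish-halted E (trans (cong (entryAfter (mem c)) runs) (resume-halted (mem c) se j final)) D unchanged)
  simulation-step t ih {c} r hd E | io-prefix j io₁ ce run stp rest refl | se , runs , D , unchanged | no running
    with normal-start rest hd (running ∘ trans (sym (Describes.state≡ D)))
                      (stopped-normal stp (running ∘ trans (sym (Describes.state≡ D))))
  ... | t₁ , refl , rest′ =
    within-weaken 𝓜′ (≤-reflexive (sym (*-suc 2 t₁))) (≤-reflexive (sym (*-distribˡ-+ 2 j io₁)))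
      (within-bind 𝓜′
        (pause-to-execute E (trans (cong (entryAfter (mem c)) runs) (resume-paused (mem c) se j running)) D unchanged)
        λ ex → within-bind 𝓜′ (execute-step ex) λ E′ → ih refl rest′ hd E′)

  simulate : ∀ t → Simulation t
  simulate zero = simulation-step zero λ ()
  simulate (suc t) = simulation-step (suc t) λ { refl → simulate t }

  preload-blank : ∀ r → preload (entryAfter (replicate (suc m) blank) r) ≡ blank
  preload-blank nothing = refl
  preload-blank (just (σ , j)) with symState σ ≟ qf
  ... | yes _ = halting (symExt σ)
    where
    halting : ∀ e → preload (haltWith (Maybe.map (lookup (replicate (suc m) blank)) e)) ≡ blank
    halting nothing = refl
    halting (just i) = lookup-replicate i blank
  ... | no _ = continuing j
    where
    continuing : ∀ j → preload (continue (replicate (suc m) blank) σ j) ≡ blank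
    continuing zero = refl
    continuing (suc _) = refl

  inputTape-agrees : ∀ x → inputTape 𝓜′ x ≗ inputTape 𝓜 x
  inputTape-agrees [] i = refl
  inputTape-agrees (a ∷ x) zero = refl
  inputTape-agrees (a ∷ x) (suc i) = inputTape-agrees x i

  entered-initial : ∀ x → Entered (initial 𝓜 x) (initial 𝓜′ x)
  entered-initial x = entered (tracks refl refl (inputTape-agrees x)) (sym (preload-blank (runSym nQ (symStart q₀ zero))))

  outputs-agree : ∀ {e e′ y} → e′ ≗ e → Outputs 𝓜 e y → Outputs 𝓜′ e′ y
  outputs-agree e′≗e (cells , end) = (λ i → trans (e′≗e _) (cells i)) , trans (e′≗e _) end

  scale-≤ : ∀ {a b} k c → a ≤ 2 * b → b ≤ k * c → a ≤ 2 * k * c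
  scale-≤ k c a≤ b≤ = ≤-trans a≤ (≤-trans (*-monoʳ-≤ 2 b≤) (≤-reflexive (sym (*-assoc 2 k c))))

  computes : ∀ {f T IO} → ComputesIn 𝓜 f T IO → ComputesIn 𝓜′ f T (λ n → T n + IO n)
  computes {f} {T} {IO} (k , N , run) = 2 * k , N , λ x →
    let (t , io , d , r , hd , out , bounds) = run x
        within t′ io′ d′ r′ (halts , ext≗) t′≤ io′≤ = simulate t r hd (entered-initial x)
        n = length x
    in t′ , io′ , d′ , r′ , halts , outputs-agree {y = f x} ext≗ out , λ N≤n →
       scale-≤ k (T n) t′≤ (proj₁ (bounds N≤n)) ,
       scale-≤ k (T n + IO n) io′≤ (≤-trans (proj₂ (bounds N≤n)) (*-monoʳ-≤ k (m≤n+m (IO n) (T n))))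

lemma1 : ∀ {s : ℕ} (f : List (Fin s) → List (Fin s)) (T IO : ℕ → ℕ) (m : ℕ) →
         Σ (TLM s (suc m)) (λ 𝓜 → ComputesIn 𝓜 f T IO) →
         Σ (TLM s 1) (λ 𝓜' → ComputesIn 𝓜' f T (λ n → T n + IO n))
lemma1 f T IO m (𝓜 , 𝓜-computes) = OneCellSimulation.𝓜′ 𝓜 , OneCellSimulation.computes 𝓜 {f} {T} {IO} 𝓜-computes
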